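{- For all positive integers $n,\ell$, \[ \frac{2}{n+2}\binom{n-1}{\ell-1}\binom{n+\ell+1}{\ell}\in\mathbb{Z}. \] -}

module Defs where

-- Absorption gives ℓ·C(n,ℓ) = n·C(n−1,ℓ−1) and, with N = n+ℓ+1, ℓ·C(N,ℓ) = (n+2)·C(N,ℓ−1).
-- Multiplying and cancelling ℓ yields n·C(n−1,ℓ−1)·C(N,ℓ) = (n+2)·C(n,ℓ)·C(N,ℓ−1), so n+2
-- divides n·X for X = C(n−1,ℓ−1)·C(N,ℓ), and therefore also (n+2)·X − n·X = 2·X.
module Submission where

open import Defs
open import Data.Nat using (ℕ; _+_; _*_; _∸_; _≥_; zero; suc)
open import Data.Nat.Divisibility using (_∣_; ∣m+n∣m⇒∣n; m∣m*n)
open import Data.Nat.Combinatorics using (_C_; nCk+nC[k+1]≡[n+1]C[k+1]; nC1≡n)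
open import Data.Nat.Properties
open import Data.Nat.Tactic.RingSolver using (solve-∀)
open import Relation.Binary.PropositionalEquality
open ≡-Reasoning

[k+1]*[n+1]C[k+1]≡[n+1]*nCk : ∀ n k → suc k * (suc n C suc k) ≡ suc n * (n C k)
[k+1]*[n+1]C[k+1]≡[n+1]*nCk zero zero = refl
[k+1]*[n+1]C[k+1]≡[n+1]*nCk zero (suc k) = *-zeroʳ (2 + k)
[k+1]*[n+1]C[k+1]≡[n+1]*nCk (suc n) zero =
  trans (*-identityˡ _) (trans (nC1≡n (2 + n)) (sym (*-identityʳ (2 + n))))
[k+1]*[n+1]C[k+1]≡[n+1]*nCk (suc n) (suc k) = begin
  (2 + k) * ((2 + n) C (2 + k))
    ≡⟨ cong ((2 + k) *_) (sym (nCk+nC[k+1]≡[n+1]C[k+1] (suc n) (suc k))) ⟩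
  (2 + k) * (a + b)
    ≡⟨ split k a b ⟩
  a + (1 + k) * a + (2 + k) * b
    ≡⟨ cong₂ (λ x y → a + x + y) ([k+1]*[n+1]C[k+1]≡[n+1]*nCk n k) ([k+1]*[n+1]C[k+1]≡[n+1]*nCk n (suc k)) ⟩
  a + (1 + n) * (n C k) + (1 + n) * (n C suc k)
    ≡⟨ +-assoc a _ _ ⟩
  a + ((1 + n) * (n C k) + (1 + n) * (n C suc k))
    ≡⟨ cong (a +_) (sym (*-distribˡ-+ (1 + n) (n C k) (n C suc k))) ⟩
  a + (1 + n) * (n C k + n C suc k)
    ≡⟨ cong (λ x → a + (1 + n) * x) (nCk+nC[k+1]≡[n+1]C[k+1] n k) ⟩
  a + (1 + n) * a
    ∎
  where
  a = suc n C suc k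
  b = suc n C (2 + k)
  split : ∀ k a b → (2 + k) * (a + b) ≡ a + (1 + k) * a + (2 + k) * b
  split = solve-∀

[k+1]*[m+k]C[k+1]≡m*[m+k]Ck : ∀ m k → suc k * ((m + k) C suc k) ≡ m * ((m + k) C k)
[k+1]*[m+k]C[k+1]≡m*[m+k]Ck m k = +-cancelʳ-≡ (suc k * c) _ _ (begin
  suc k * (N C suc k) + suc k * c ≡⟨ sym (*-distribˡ-+ (suc k) (N C suc k) c) ⟩
  suc k * (N C suc k + c)         ≡⟨ cong (suc k *_) (+-comm (N C suc k) c) ⟩
  suc k * (c + N C suc k)         ≡⟨ cong (suc k *_) (nCk+nC[k+1]≡[n+1]C[k+1] N k) ⟩
  suc k * (suc N C suc k)         ≡⟨ [k+1]*[n+1]C[k+1]≡[n+1]*nCk N k ⟩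
  suc (m + k) * c                 ≡⟨ cong (_* c) (+-suc m k) ⟨
  (m + suc k) * c                 ≡⟨ *-distribʳ-+ c m (suc k) ⟩
  m * c + suc k * c               ∎)
  where
  N = m + k
  c = N C k

-- Both sides times k+1 equal ((m+1)·C(m,k))·((k+1)·C(M+k,k+1)), by the two absorption identities.
[m+1]*mCk*[M+k]C[k+1]≡M*[m+1]C[k+1]*[M+k]Ck : ∀ m k M →
  suc m * ((m C k) * ((M + k) C suc k)) ≡ M * ((suc m C suc k) * ((M + k) C k))
[m+1]*mCk*[M+k]C[k+1]≡M*[m+1]C[k+1]*[M+k]Ck m k M = *-cancelˡ-≡ _ _ (suc k) (begin
  suc k * (suc m * (c * e)) ≡⟨ regroupˡ (suc k) (suc m) c e ⟩
  (suc m * c) * (suc k * e) ≡⟨ cong₂ _*_ (sym ([k+1]*[n+1]C[k+1]≡[n+1]*nCk m k)) ([k+1]*[m+k]C[k+1]≡m*[m+k]Ck M k) ⟩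
  (suc k * g) * (M * f)     ≡⟨ regroupʳ (suc k) M g f ⟩
  suc k * (M * (g * f))     ∎)
  where
  c = m C k
  e = (M + k) C suc k
  f = (M + k) C k
  g = suc m C suc k
  regroupˡ : ∀ x y c e → x * (y * (c * e)) ≡ (y * c) * (x * e)
  regroupˡ = solve-∀
  regroupʳ : ∀ x M g f → (x * g) * (M * f) ≡ x * (M * (g * f))
  regroupʳ = solve-∀

m+n∣m*o⇒m+n∣n*o : ∀ m n o → m + n ∣ m * o → m + n ∣ n * o
m+n∣m*o⇒m+n∣n*o m n o m+n∣m*o =
  ∣m+n∣m⇒∣n (subst (m + n ∣_) (*-distribʳ-+ o m n) (m∣m*n o)) m+n∣m*o

lemma2p4 : (n ℓ : ℕ) → n ≥ 1 → ℓ ≥ 1 →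
           (n + 2) ∣ (2 * ((n ∸ 1) C (ℓ ∸ 1)) * ((n + ℓ + 1) C ℓ))
lemma2p4 (suc m) (suc k) _ _ =
  subst (suc m + 2 ∣_) (sym (*-assoc 2 (m C k) (N C suc k))) n+2∣2*product
  where
  N = suc m + suc k + 1
  N≡[n+2]+k : N ≡ suc m + 2 + k
  N≡[n+2]+k = reassociate m k
    where
    reassociate : ∀ m k → suc m + suc k + 1 ≡ suc m + 2 + k
    reassociate = solve-∀
  product-identity : suc m * ((m C k) * (N C suc k)) ≡ (suc m + 2) * ((suc m C suc k) * (N C k))
  product-identity =
    subst (λ x → suc m * ((m C k) * (x C suc k)) ≡ (suc m + 2) * ((suc m C suc k) * (x C k)))
          (sym N≡[n+2]+k) ([m+1]*mCk*[M+k]C[k+1]≡M*[m+1]C[k+1]*[M+k]Ck m k (suc m + 2))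
  n+2∣2*product : suc m + 2 ∣ 2 * ((m C k) * (N C suc k))
  n+2∣2*product = m+n∣m*o⇒m+n∣n*o (suc m) 2 _ (subst (suc m + 2 ∣_) (sym product-identity) (m∣m*n _))
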